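{- Let $n\ge 1$ and let $t_1,\dots,t_n$ be nonnegative integers. Then $P'(t_1,t_2,\ldots,t_n)>0$ if and only if $2t_k\le\sum_{i=1}^n t_i$ holds for every $k\in\{1,\dots,n\}$.
   Context: $P'(t_1,\dots,t_n)$ is the number of anagrams without fixed letters of the word $1^{t_1}2^{t_2}\cdots n^{t_n}$ (the letter $i$ repeated $t_i$ times, in this order), i.e. the number of words $a_{1,1}\ldots a_{1,t_1}a_{2,1}\ldots a_{2,t_2}\ldots a_{n,1}\ldots a_{n,t_n}$ that are rearrangements of $1^{t_1}2^{t_2}\cdots n^{t_n}$ and satisfy $a_{i,j}\neq i$ for all $i,j$. (If all $t_i=0$, the empty word counts, so the value is $1$.) -}

module Defs where

open import Data.Nat using (ℕ; zero; suc; _+_)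
open import Data.Bool using (Bool; true; false; _∧_; not)
open import Data.Fin using (Fin)
open import Data.Fin.Properties using (_≟_)
open import Data.Nat using () renaming (_≡ᵇ_ to _==ℕ_)
open import Data.Bool.ListAction using (and)
open import Data.Nat.ListAction using (sum)
open import Data.List using (List; []; _∷_; length; concatMap; replicate; concat; map; allFin; tabulate; zipWith)
import Data.List as L
open import Relation.Nullary.Decidable using (⌊_⌋)

-- The word 1^{t_1} 2^{t_2} ... n^{t_n}; letters are Fin n (letter i+1 ↦ i).
word : (n : ℕ) → (Fin n → ℕ) → List (Fin n)
word n t = concat (tabulate {n = n} (λ i → replicate (t i) i))

allWords : (n m : ℕ) → List (List (Fin n))
allWords n zero    = [] ∷ []
allWords n (suc m) = concatMap (λ a → map (a ∷_) (allWords n m)) (allFin n)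

occ : ∀ {n} → Fin n → List (Fin n) → ℕ
occ a [] = 0
occ a (b ∷ w) = if⌊ a , b ⌋ (suc (occ a w)) (occ a w)
  where
  if⌊_,_⌋ : ∀ {n} → Fin n → Fin n → ℕ → ℕ → ℕ
  if⌊ x , y ⌋ p q with ⌊ x ≟ y ⌋
  ... | true  = p
  ... | false = q

-- v is a rearrangement of w: every letter occurs equally often in both
-- (v is generated with length(w), so this is the multiset condition).
isRearrangement : ∀ {n} → List (Fin n) → List (Fin n) → Bool
isRearrangement {n} v w = and (map (λ a → occ a v ==ℕ occ a w) (allFin n))

noFixedLetter : ∀ {n} → List (Fin n) → List (Fin n) → Bool
noFixedLetter v w = and (zipWith (λ a b → not ⌊ a ≟ b ⌋) v w)

-- P'(t_1,…,t_n): number of anagrams without fixed letters of word n t.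
P′ : (n : ℕ) → (Fin n → ℕ) → ℕ
P′ n t = length (L.filterᵇ (λ v → isRearrangement v w ∧ noFixedLetter v w)
                           (allWords n (length w)))
  where w = word n t

total : (n : ℕ) → (Fin n → ℕ) → ℕ
total n t = sum (tabulate {n = n} t)

module Submission where

-- Write w = 1^{t₁}⋯n^{tₙ} and L = |w|.  Both directions are about a
-- "fixed-free anagram" of w: a word v of length L with the same letter
-- counts as w and vᵢ ≠ wᵢ at every position i (relation `Differ`).
--
-- Necessity: no position carries the letter k in both v and w, so
--   occ k v + occ k w ≤ L, i.e. 2tₖ ≤ L (`count-bound`).
-- Sufficiency: let m = max tᵢ.  Since w is sorted into blocks of length
--   ≤ d, shifting w by any d ≥ m changes every letter (`shift-differs`).
--   The rotation v = drop m w ++ take m w compares w with its shifts by m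
--   and by L ∸ m, both ≥ m because 2m ≤ L (`rotate-differs`); being a
--   rotation, v is an anagram of w.

open import Defs
open import Data.Nat using (ℕ; zero; suc; _+_; _*_; _∸_; _≤_; _<_; z≤n; s≤s; _≡ᵇ_)
open import Data.Nat.Properties as ℕ
  using (+-comm; +-suc; +-identityʳ; ≤-trans; m≤n⇒m≤1+n; m+n≤o⇒m≤o∸n; m≤n⇒∃[o]m+o≡n; ≡ᵇ⇒≡; ≡⇒≡ᵇ)
open import Data.Fin using (Fin; zero; suc)
open import Data.Fin.Properties using (_≟_) renaming (suc-injective to Fin-suc-injective)
open import Data.Bool using (Bool; T; _∧_)
open import Data.Bool.Properties using (T-∧)
open import Data.List
  using (List; []; _∷_; _++_; length; map; replicate; take; drop; allFin; concat; tabulate; filter)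
open import Data.List.Properties
  using (length-++; length-replicate; length-map; length-drop; map-replicate; map-tabulate;
         tabulate-cong; concat-map; drop-map; drop-drop; take++drop≡id; filter-some)
open import Data.List.Relation.Unary.Any using (here; satisfied)
import Data.List.Relation.Unary.All as All
open import Data.List.Relation.Unary.All.Properties using (all⁺; all⁻)
open import Data.List.Membership.Propositional using (_∈_; lose)
open import Data.List.Membership.Propositional.Properties
  using (∈-allFin; ∈-map⁺; ∈-map⁻; ∈-concatMap⁺; ∈-concatMap⁻; ∈-filter⁻)
open import Data.List.Extrema.Nat using (argmax; f[xs]≤f[argmax])
open import Data.Product using (∃; _,_)
open import Data.Empty using (⊥-elim)
open import Function using (_∘_)
open import Function.Definitions using (Injective)
open import Function.Bundles using (_⇔_; mk⇔; Equivalence)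
open import Relation.Nullary using (yes; no)
open import Relation.Nullary.Decidable using (T?)
open import Relation.Binary.PropositionalEquality
  using (_≡_; _≢_; refl; sym; trans; cong; cong₂; subst; subst₂; module ≡-Reasoning)

open Equivalence using (to; from)

occ-here : ∀ {n} (a : Fin n) (w : List (Fin n)) → occ a (a ∷ w) ≡ suc (occ a w)
occ-here a w with a ≟ a
... | yes _   = refl
... | no a≢a = ⊥-elim (a≢a refl)

occ-there : ∀ {n} {a b : Fin n} (w : List (Fin n)) → a ≢ b → occ a (b ∷ w) ≡ occ a w
occ-there {a = a} {b} w a≢b with a ≟ b
... | yes a≡b = ⊥-elim (a≢b a≡b)
... | no _    = refl

occ-++ : ∀ {n} (a : Fin n) (x y : List (Fin n)) → occ a (x ++ y) ≡ occ a x + occ a y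
occ-++ a []      y = refl
occ-++ a (b ∷ x) y with a ≟ b
... | yes _ = cong suc (occ-++ a x y)
... | no _  = occ-++ a x y

occ-swap : ∀ {n} (a : Fin n) (x y : List (Fin n)) → occ a (y ++ x) ≡ occ a (x ++ y)
occ-swap a x y = begin
  occ a (y ++ x)       ≡⟨ occ-++ a y x ⟩
  occ a y + occ a x    ≡⟨ +-comm (occ a y) (occ a x) ⟩
  occ a x + occ a y    ≡⟨ occ-++ a x y ⟨
  occ a (x ++ y)       ∎
  where open ≡-Reasoning

occ-replicate-self : ∀ {n} (a : Fin n) c → occ a (replicate c a) ≡ c
occ-replicate-self a zero    = refl
occ-replicate-self a (suc c) = trans (occ-here a (replicate c a)) (cong suc (occ-replicate-self a c))

occ-replicate-other : ∀ {n} {a b : Fin n} c → a ≢ b → occ a (replicate c b) ≡ 0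
occ-replicate-other zero    _   = refl
occ-replicate-other (suc c) a≢b = trans (occ-there (replicate c _) a≢b) (occ-replicate-other c a≢b)

occ-map-injective : ∀ {m n} {f : Fin m → Fin n} → Injective _≡_ _≡_ f →
                    ∀ a w → occ (f a) (map f w) ≡ occ a w
occ-map-injective inj a []      = refl
occ-map-injective {f = f} inj a (b ∷ w) with a ≟ b
... | yes refl = trans (occ-here (f a) (map f w)) (cong suc (occ-map-injective inj a w))
... | no a≢b   = trans (occ-there (map f w) (a≢b ∘ inj)) (occ-map-injective inj a w)

occ-map-outside : ∀ {m n} {f : Fin m → Fin n} {b : Fin n} → (∀ x → b ≢ f x) →
                  ∀ w → occ b (map f w) ≡ 0
occ-map-outside outside []      = refl
occ-map-outside outside (x ∷ w) = trans (occ-there (map _ w) (outside x)) (occ-map-outside outside w)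

occ≤length : ∀ {n} (k : Fin n) w → occ k w ≤ length w
occ≤length k []      = z≤n
occ≤length k (b ∷ w) with k ≟ b
... | yes _ = s≤s (occ≤length k w)
... | no _  = m≤n⇒m≤1+n (occ≤length k w)

word-suc : ∀ n (t : Fin (suc n) → ℕ) →
           word (suc n) t ≡ replicate (t zero) zero ++ map suc (word n (t ∘ suc))
word-suc n t = cong (replicate (t zero) zero ++_) (begin
    concat (tabulate (λ i → replicate (t (suc i)) (suc i)))
  ≡⟨ cong concat (tabulate-cong (λ i → sym (map-replicate suc (t (suc i)) i))) ⟩
    concat (tabulate (λ i → map suc (replicate (t (suc i)) i)))
  ≡⟨ cong concat (sym (map-tabulate (λ i → replicate (t (suc i)) i) (map suc))) ⟩
    concat (map (map suc) (tabulate (λ i → replicate (t (suc i)) i)))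
  ≡⟨ concat-map (tabulate (λ i → replicate (t (suc i)) i)) ⟩
    map suc (word n (t ∘ suc)) ∎)
  where open ≡-Reasoning

length-word : ∀ n t → length (word n t) ≡ total n t
length-word zero    t = refl
length-word (suc n) t rewrite word-suc n t = begin
  length (replicate (t zero) zero ++ map suc w′)   ≡⟨ length-++ (replicate (t zero) zero) ⟩
  length (replicate (t zero) zero) + length (map suc w′)
    ≡⟨ cong₂ _+_ (length-replicate (t zero)) (length-map suc w′) ⟩
  t zero + length w′                               ≡⟨ cong (t zero +_) (length-word n (t ∘ suc)) ⟩
  t zero + total n (t ∘ suc)                       ∎
  where
  open ≡-Reasoning
  w′ : List (Fin n)
  w′ = word n (t ∘ suc)

occ-word : ∀ n t (k : Fin n) → occ k (word n t) ≡ t k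
occ-word (suc n) t k = begin
  occ k (word (suc n) t)              ≡⟨ cong (occ k) (word-suc n t) ⟩
  occ k (zeros ++ map suc w′)         ≡⟨ occ-++ k zeros (map suc w′) ⟩
  occ k zeros + occ k (map suc w′)    ≡⟨ blocks k ⟩
  t k                                 ∎
  where
  open ≡-Reasoning
  zeros : List (Fin (suc n))
  zeros = replicate (t zero) zero
  w′ : List (Fin n)
  w′ = word n (t ∘ suc)
  -- letter zero lives only in the first block, every other letter only in the rest
  blocks : ∀ k → occ k zeros + occ k (map suc w′) ≡ t k
  blocks zero    = trans (cong₂ _+_ (occ-replicate-self zero (t zero)) (occ-map-outside (λ _ ()) w′))
                         (+-identityʳ (t zero))
  blocks (suc j) = cong₂ _+_ (occ-replicate-other (t zero) (λ ()))
                             (trans (occ-map-injective Fin-suc-injective j w′) (occ-word n (t ∘ suc) j))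

-- `Differ v w`: vᵢ ≠ wᵢ wherever both are defined (lengths may differ).
data Differ {n : ℕ} : List (Fin n) → List (Fin n) → Set where
  []ˡ : ∀ {w} → Differ [] w
  []ʳ : ∀ {v} → Differ v []
  _∷_ : ∀ {a b v w} → a ≢ b → Differ v w → Differ (a ∷ v) (b ∷ w)

noFixedLetter⇔Differ : ∀ {n} (v w : List (Fin n)) → T (noFixedLetter v w) ⇔ Differ v w
noFixedLetter⇔Differ v w = mk⇔ (sound v w) (complete v w)
  where
  sound : ∀ {n} (v w : List (Fin n)) → T (noFixedLetter v w) → Differ v w
  sound []      w       _ = []ˡ
  sound (a ∷ v) []      _ = []ʳ
  sound (a ∷ v) (b ∷ w) h with a ≟ b
  ... | no a≢b = a≢b ∷ sound v w h
  complete : ∀ {n} (v w : List (Fin n)) → Differ v w → T (noFixedLetter v w)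
  complete []      w       _ = _
  complete (a ∷ v) []      _ = _
  complete (a ∷ v) (b ∷ w) (a≢b ∷ d) with a ≟ b
  ... | yes a≡b = a≢b a≡b
  ... | no _    = complete v w d

Differ-sym : ∀ {n} {v w : List (Fin n)} → Differ v w → Differ w v
Differ-sym []ˡ       = []ʳ
Differ-sym []ʳ       = []ˡ
Differ-sym (a≢b ∷ d) = (a≢b ∘ sym) ∷ Differ-sym d

Differ-take : ∀ {n} j {x z : List (Fin n)} → Differ x z → Differ (take j x) z
Differ-take zero    d         = []ˡ
Differ-take (suc j) []ˡ       = []ˡ
Differ-take (suc j) {[]} []ʳ  = []ˡ
Differ-take (suc j) {_ ∷ _} []ʳ = []ʳ
Differ-take (suc j) (a≢b ∷ d) = a≢b ∷ Differ-take j d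

Differ-++ˡ : ∀ {n} (x : List (Fin n)) {y z} → Differ x z → Differ y (drop (length x) z) →
             Differ (x ++ y) z
Differ-++ˡ []      dx        dy = dy
Differ-++ˡ (a ∷ x) {z = []} dx dy = []ʳ
Differ-++ˡ (a ∷ x) (a≢b ∷ dx) dy = a≢b ∷ Differ-++ˡ x dx dy

Differ-++ʳ : ∀ {n} {x} (z : List (Fin n)) {y} → Differ x z → Differ (drop (length z) x) y →
             Differ x (z ++ y)
Differ-++ʳ z dz dy = Differ-sym (Differ-++ˡ z (Differ-sym dz) (Differ-sym dy))

Differ-map-injective : ∀ {m n} {f : Fin m → Fin n} → Injective _≡_ _≡_ f →
                       ∀ {v w} → Differ v w → Differ (map f v) (map f w)
Differ-map-injective inj []ˡ = []ˡ
Differ-map-injective inj {[]} []ʳ = []ˡ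
Differ-map-injective inj {_ ∷ _} []ʳ = []ʳ
Differ-map-injective inj (a≢b ∷ d) = (a≢b ∘ inj) ∷ Differ-map-injective inj d

Differ-map-outside : ∀ {m n} {f : Fin m → Fin n} {b : Fin n} → (∀ x → b ≢ f x) →
                     ∀ u c → Differ (map f u) (replicate c b)
Differ-map-outside outside []      c       = []ˡ
Differ-map-outside outside (x ∷ u) zero    = []ʳ
Differ-map-outside outside (x ∷ u) (suc c) = (outside x ∘ sym) ∷ Differ-map-outside outside u c

-- Necessity: a letter occupies at most half of the positions

-- If v and w have the same length and differ everywhere, no position
-- carries k in both, so the occurrences of k in v and w together fit
-- into the |w| positions.
count-bound : ∀ {n} (k : Fin n) {v w : List (Fin n)} → Differ v w → length v ≡ length w →
              occ k v + occ k w ≤ length w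
count-bound k {w = w} []ˡ       _ = occ≤length k w
count-bound k {[]}    []ʳ       _ = z≤n
count-bound k {a ∷ v} {b ∷ w} (a≢b ∷ d) same with count-bound k d (ℕ.suc-injective same) | k ≟ a | k ≟ b
... | _  | yes refl | yes refl = ⊥-elim (a≢b refl)
... | ih | yes _ | no _  = s≤s ih
... | ih | no _  | yes _ rewrite +-suc (occ k v) (occ k w) = s≤s ih
... | ih | no _  | no _  = m≤n⇒m≤1+n ih

-- Sufficiency: a rotation of the word by its longest block

drop-replicate-++ : ∀ {A : Set} c e (x : A) ys → drop (c + e) (replicate c x ++ ys) ≡ drop e ys
drop-replicate-++ zero    e x ys = refl
drop-replicate-++ (suc c) e x ys = drop-replicate-++ c e x ys

-- Every block of 1^{t₁}⋯n^{tₙ} has length ≤ d, so shifting the word by d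
-- positions changes the letter at every position.
shift-differs : ∀ n (t : Fin n → ℕ) d → (∀ i → t i ≤ d) → Differ (drop d (word n t)) (word n t)
shift-differs zero    t d _ = []ʳ
shift-differs (suc n) t d bounded with e , refl ← m≤n⇒∃[o]m+o≡n (bounded zero) =
  subst (λ w → Differ (drop (c + e) w) w) (sym (word-suc n t)) shifted
  where
  c : ℕ
  c  = t zero
  w′ : List (Fin n)
  w′ = word n (t ∘ suc)
  zeros : List (Fin (suc n))
  zeros = replicate c zero
  M : List (Fin (suc n))
  M = map suc w′
  dropped : drop (c + e) (zeros ++ M) ≡ map suc (drop e w′)
  dropped = trans (drop-replicate-++ c e zero M) (drop-map e w′)
  -- the part that lies under the remaining blocks is again a d-shift
  under-rest : drop (length zeros) (map suc (drop e w′)) ≡ drop (c + e) M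
  under-rest = begin
    drop (length zeros) (map suc (drop e w′)) ≡⟨ cong (λ j → drop j (map suc (drop e w′))) (length-replicate c) ⟩
    drop c (map suc (drop e w′))              ≡⟨ cong (drop c) (drop-map e w′) ⟨
    drop c (drop e M)                         ≡⟨ drop-drop e c M ⟩
    drop (e + c) M                            ≡⟨ cong (λ j → drop j M) (+-comm e c) ⟩
    drop (c + e) M                            ∎
    where open ≡-Reasoning
  rest : Differ (drop (c + e) M) M
  rest = subst (λ x → Differ x M) (sym (drop-map (c + e) w′))
           (Differ-map-injective Fin-suc-injective (shift-differs n (t ∘ suc) (c + e) (bounded ∘ suc)))
  shifted : Differ (drop (c + e) (zeros ++ M)) (zeros ++ M)
  shifted rewrite dropped =
    Differ-++ʳ zeros (Differ-map-outside (λ _ ()) (drop e w′) c)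
                     (subst (λ x → Differ x M) (sym under-rest) rest)

rotate : ∀ {A : Set} → ℕ → List A → List A
rotate m w = drop m w ++ take m w

length-rotate : ∀ {A : Set} m (w : List A) → length (rotate m w) ≡ length w
length-rotate m w = begin
  length (drop m w ++ take m w)          ≡⟨ length-++ (drop m w) ⟩
  length (drop m w) + length (take m w)  ≡⟨ +-comm (length (drop m w)) _ ⟩
  length (take m w) + length (drop m w)  ≡⟨ length-++ (take m w) ⟨
  length (take m w ++ drop m w)          ≡⟨ cong length (take++drop≡id m w) ⟩
  length w                               ∎
  where open ≡-Reasoning

occ-rotate : ∀ {n} m (a : Fin n) w → occ a (rotate m w) ≡ occ a w
occ-rotate m a w = trans (occ-swap a (take m w) (drop m w)) (cong (occ a) (take++drop≡id m w))

rotate-differs : ∀ {n} m (w : List (Fin n)) →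
                 Differ (drop m w) w → Differ (drop (length w ∸ m) w) w → Differ (rotate m w) w
rotate-differs m w front back = Differ-++ˡ (drop m w) front
  (subst (λ j → Differ (take m w) (drop j w)) (sym (length-drop m w))
         (Differ-take m (Differ-sym back)))

record FixedFreeAnagram {n : ℕ} (w : List (Fin n)) : Set where
  field
    anagram     : List (Fin n)
    same-length : length anagram ≡ length w
    same-counts : ∀ a → occ a anagram ≡ occ a w
    no-fixed    : Differ anagram w

fixedFreeCount : ∀ {n} → List (Fin n) → ℕ
fixedFreeCount {n} w =
  length (filter (T? ∘ λ v → isRearrangement v w ∧ noFixedLetter v w) (allWords n (length w)))

allWords-complete : ∀ n (v : List (Fin n)) → v ∈ allWords n (length v)
allWords-complete n []      = here refl
allWords-complete n (a ∷ v) =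
  ∈-concatMap⁺ (λ b → map (b ∷_) (allWords n (length v)))
    (lose (∈-allFin a) (∈-map⁺ (a ∷_) (allWords-complete n v)))

allWords-sound : ∀ n m {v : List (Fin n)} → v ∈ allWords n m → length v ≡ m
allWords-sound n zero    (here refl) = refl
allWords-sound n (suc m) v∈
  with _ , v∈′ ← satisfied (∈-concatMap⁻ (λ b → map (b ∷_) (allWords n m)) {xs = allFin n} v∈)
  with _ , u∈ , refl ← ∈-map⁻ _ v∈′ = cong suc (allWords-sound n m u∈)

isRearrangement⇔ : ∀ {n} (v w : List (Fin n)) → T (isRearrangement v w) ⇔ (∀ a → occ a v ≡ occ a w)
isRearrangement⇔ {n} v w = mk⇔
  (λ h a → ≡ᵇ⇒≡ _ _ (All.lookup (all⁺ test (allFin n) h) (∈-allFin a)))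
  (λ h → all⁻ test {xs = allFin n} (All.tabulate λ {a} _ → ≡⇒≡ᵇ _ _ (h a)))
  where
  test : Fin n → Bool
  test a = occ a v ≡ᵇ occ a w

nonempty-member : ∀ {A : Set} (xs : List A) → 0 < length xs → ∃ (_∈ xs)
nonempty-member (x ∷ _) _ = x , here refl

fixedFree-positive⇔ : ∀ {n} (w : List (Fin n)) → 0 < fixedFreeCount w ⇔ FixedFreeAnagram w
fixedFree-positive⇔ {n} w = mk⇔ extract insert
  where
  isAnswer : List (Fin n) → Bool
  isAnswer v = isRearrangement v w ∧ noFixedLetter v w
  extract : 0 < fixedFreeCount w → FixedFreeAnagram w
  extract pos with v , v∈ ← nonempty-member _ pos
              with v∈all , ok ← ∈-filter⁻ (T? ∘ isAnswer) v∈
              with rearr , nofix ← to T-∧ ok = record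
    { anagram     = v
    ; same-length = allWords-sound n (length w) v∈all
    ; same-counts = to (isRearrangement⇔ v w) rearr
    ; no-fixed    = to (noFixedLetter⇔Differ v w) nofix }
  insert : FixedFreeAnagram w → 0 < fixedFreeCount w
  insert record { anagram = v ; same-length = len ; same-counts = counts ; no-fixed = d } =
    filter-some (T? ∘ isAnswer)
      (lose (subst (λ m → v ∈ allWords n m) len (allWords-complete n v))
            (from T-∧ (from (isRearrangement⇔ v w) counts , from (noFixedLetter⇔Differ v w) d)))

necessary : ∀ n (t : Fin n → ℕ) → FixedFreeAnagram (word n t) → ∀ k → 2 * t k ≤ total n t
necessary n t v k = subst₂ _≤_ twice (length-word n t) (count-bound k no-fixed same-length)
  where
  open FixedFreeAnagram v
  twice : occ k anagram + occ k (word n t) ≡ 2 * t k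
  twice rewrite same-counts k | occ-word n t k | +-identityʳ (t k) = refl

-- Sufficiency: rotate w by m = max tᵢ (argmax exists as n ≥ 1); 2m ≤ |w| gives m ≤ |w| ∸ m.
sufficient : ∀ n (t : Fin (suc n) → ℕ) → (∀ k → 2 * t k ≤ total (suc n) t) →
             FixedFreeAnagram (word (suc n) t)
sufficient n t balanced = record
  { anagram     = rotate m w
  ; same-length = length-rotate m w
  ; same-counts = λ a → occ-rotate m a w
  ; no-fixed    = rotate-differs m w (shift-differs (suc n) t m maximal)
                    (shift-differs (suc n) t (length w ∸ m) (λ i → ≤-trans (maximal i) m≤rest)) }
  where
  w : List (Fin (suc n))
  w = word (suc n) t
  k : Fin (suc n)
  k = argmax t zero (allFin (suc n))
  m : ℕ
  m = t k
  maximal : ∀ i → t i ≤ m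
  maximal i = All.lookup (f[xs]≤f[argmax] {f = t} zero (allFin (suc n))) (∈-allFin i)
  m≤rest : m ≤ length w ∸ m
  m≤rest = m+n≤o⇒m≤o∸n m
    (subst₂ (λ x y → m + x ≤ y) (+-identityʳ m) (sym (length-word (suc n) t)) (balanced k))

theorem2p3 : (n : ℕ) → 1 ≤ n → (t : Fin n → ℕ) →
    (0 < P′ n t) ⇔ (∀ (k : Fin n) → 2 * t k ≤ total n t)
theorem2p3 (suc n) _ t = mk⇔
  (necessary (suc n) t ∘ to (fixedFree-positive⇔ (word (suc n) t)))
  (from (fixedFree-positive⇔ (word (suc n) t)) ∘ sufficient n t)
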